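{- Let $\tau:S_{0}\cup S_{1}\to\omega$ be given by $\tau(w)=|w|_{v}$. Let $D\subseteq S_{0}$ be a $C$-set in $(S_{0},\cdot)$ and let $\langle x_{n}\rangle_{n=1}^{\infty}$ be a sequence in $\mathbb{N}$. Then there exists a sequence $\langle w_{n}\rangle_{n=1}^{\infty}$ in $S_{1}$ such that for every finite nonempty $G=\{n_{1}<n_{2}<\cdots<n_{l}\}\subseteq\mathbb{N}$, \[ \{w_{n_{1}}(a_{1})w_{n_{2}}(a_{2})\cdots w_{n_{l}}(a_{l}):a_{i}\in\mathbb{A}_{n_{i}}\text{ for }i=1,\dots,l\}\subseteq D \] and $\sum_{i=1}^{l}\tau(w_{n_{i}})\in\mathrm{FS}(\langle x_{n}\rangle_{n=1}^{\infty})$.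
   Context: Let $\mathbb{A}_{1}\subseteq\mathbb{A}_{2}\subseteq\cdots$ be an increasing sequence of finite nonempty alphabets and $\mathbb{A}=\bigcup_{i}\mathbb{A}_{i}$; $\omega=\mathbb{N}\cup\{0\}$. $S_{0}$ is the set of all nonempty finite words over $\mathbb{A}$, a semigroup under concatenation. Let $v$ be a variable not in $\mathbb{A}$; $S_{1}$ is the set of words over $\mathbb{A}\cup\{v\}$ in which $v$ occurs at least once; $|w|_{v}$ is the number of occurrences of $v$ in $w$. For $w\in S_{1}$ and $a\in\mathbb{A}$, $w(a)$ is obtained by replacing each $v$ by $a$. $\mathrm{FS}(\langle x_{n}\rangle)=\{\sum_{n\in H}x_{n}:H\subseteq\mathbb{N}\text{ finite nonempty}\}$. For a semigroup $S$, $B\subseteq S$ is a $J$-set if for every finite nonempty set $F$ of sequences $f:\mathbb{N}\to S$ there exist $m\in\mathbb{N}$, $a_{1},\dots,a_{m+1}\in S$ and $t_{1}<\cdots<t_{m}$ with $a_{1}f(t_{1})\cdots a_{m}f(t_{m})a_{m+1}\in B$ for all $f\in F$; $J(S)$ is the set of $p\in\beta S$ all of whose members are $J$-sets; $B$ is a $C$-set if $B\in p$ for some idempotent $p\in J(S)$. -}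

module Defs where

open import Level using (0ℓ)
open import Data.Nat using (ℕ; zero; suc; _+_; _≤_)
open import Data.Fin using (Fin; zero; suc) renaming (_<_ to _<ᶠ_)
open import Data.Maybe using (Maybe; just; nothing; fromMaybe)
open import Data.List using (List; []; _∷_)
open import Data.List.NonEmpty using (List⁺; _∷_; _⁺++⁺_) renaming (map to map⁺; toList to toList⁺)
open import Data.Product using (Σ; Σ-syntax; ∃; ∃-syntax; _×_; _,_; proj₁)
open import Data.Sum using (_⊎_)
open import Data.Empty using (⊥)
open import Data.Unit using (⊤)
open import Relation.Nullary using (¬_)
open import Relation.Unary using (Pred; _⊆_; _∩_; ∁; ∅; _∈_)
open import Relation.Binary.PropositionalEquality using (_≡_)
import Data.List.Membership.Propositional as LMem
open import Function using (_∘_)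

module SemigroupNotions (S : Set) (_∙_ : S → S → S) where

  StrictlyIncreasing : ∀ {m} → (Fin m → ℕ) → Set
  StrictlyIncreasing t = ∀ i j → i <ᶠ j → Data.Nat._<_ (t i) (t j)

  jprod : ∀ m → (Fin (suc m) → S) → (Fin m → S) → S
  jprod zero    a y = a zero
  jprod (suc m) a y = (a zero ∙ y zero) ∙ jprod m (a ∘ suc) (y ∘ suc)

  -- Finite nonempty sets of sequences are given as nonempty lists.
  IsJSet : Pred S 0ℓ → Set
  IsJSet B =
    (F : List⁺ (ℕ → S)) →
    Σ[ k ∈ ℕ ] Σ[ a ∈ (Fin (suc (suc k)) → S) ] Σ[ t ∈ (Fin (suc k) → ℕ) ]
      (StrictlyIncreasing t ×
       (∀ f → f LMem.∈ toList⁺ F →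
          jprod (suc k) a (f ∘ t) ∈ B))

  record IsUltrafilter (p : Pred (Pred S 0ℓ) 0ℓ) : Set₁ where
    field
      empty∉   : ¬ (∅ ∈ p)
      upward   : ∀ {A B} → A ∈ p → A ⊆ B → B ∈ p
      inter    : ∀ {A B} → A ∈ p → B ∈ p → (A ∩ B) ∈ p
      ultra    : ∀ A → (A ∈ p) ⊎ (∁ A ∈ p)

  _⁻¹·_ : S → Pred S 0ℓ → Pred S 0ℓ
  (x ⁻¹· A) y = (x ∙ y) ∈ A

  _·β_ : Pred (Pred S 0ℓ) 0ℓ → Pred (Pred S 0ℓ) 0ℓ → Pred (Pred S 0ℓ) 0ℓ
  (p ·β q) A = (λ x → (x ⁻¹· A) ∈ q) ∈ p

  IsIdempotent : Pred (Pred S 0ℓ) 0ℓ → Set₁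
  IsIdempotent p = ∀ A → ((A ∈ (p ·β p) → A ∈ p) × (A ∈ p → A ∈ (p ·β p)))

  InJ : Pred (Pred S 0ℓ) 0ℓ → Set₁
  InJ p = ∀ A → A ∈ p → IsJSet A

  IsCSet : Pred S 0ℓ → Set₁
  IsCSet B = Σ[ p ∈ Pred (Pred S 0ℓ) 0ℓ ]
    (IsUltrafilter p × IsIdempotent p × InJ p × B ∈ p)

-- Words.  Letters form a type A; S₀ = nonempty words over A;
-- S₁ = nonempty words over A ∪ {v}, with v represented by `nothing`,
-- in which v occurs at least once.

module Words (A : Set) where

  S₀ : Set
  S₀ = List⁺ A

  countV : List (Maybe A) → ℕ
  countV []            = 0
  countV (nothing ∷ w) = suc (countV w)
  countV (just _ ∷ w)  = countV w

  τ : List⁺ (Maybe A) → ℕ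
  τ w = countV (toList⁺ w)

  S₁ : Set
  S₁ = Σ[ w ∈ List⁺ (Maybe A) ] (1 ≤ τ w)

  subst₁ : S₁ → A → S₀
  subst₁ w a = map⁺ (fromMaybe a) (proj₁ w)

  τ₁ : S₁ → ℕ
  τ₁ w = τ (proj₁ w)

  concatF : ∀ l → (Fin (suc l) → S₀) → S₀
  concatF zero    u = u zero
  concatF (suc l) u = u zero ⁺++⁺ concatF l (u ∘ suc)

∑ : ∀ l → (Fin l → ℕ) → ℕ
∑ zero    f = 0
∑ (suc l) f = f zero + ∑ l (f ∘ suc)

StrictlyIncreasingℕ : ∀ {m} → (Fin m → ℕ) → Set
StrictlyIncreasingℕ t = ∀ i j → i <ᶠ j → Data.Nat._<_ (t i) (t j)

FS : (ℕ → ℕ) → Pred ℕ 0ℓ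
FS x s = Σ[ l ∈ ℕ ] Σ[ n ∈ (Fin (suc l) → ℕ) ]
  (StrictlyIncreasingℕ n × s ≡ ∑ (suc l) (x ∘ n))

-- Fix an idempotent ultrafilter p ∈ J(S₀) containing D and build w₀, w₁, … together
-- with a decreasing chain D = C₀ ⊇ C₁ ⊇ ⋯ of members of p and a threshold Nₙ on the
-- indices of x used so far.  At stage n, idempotence puts C⋆ = {y ∈ Cₙ : y⁻¹Cₙ ∈ p}
-- in p, and its J-set property, applied to the finitely many sequences
-- t ↦ b^{x(Nₙ+t)} (b ∈ 𝔸ₙ), gives α₀ f(t₀) ⋯ αₖ f(tₖ) αₖ₊₁ ∈ C⋆ for all of them at once.
-- Writing v^{x(Nₙ+tᵢ)} in place of f(tᵢ) yields wₙ with wₙ(b) ∈ C⋆ for b ∈ 𝔸ₙ and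
-- τ(wₙ) = ∑ᵢ x(Nₙ+tᵢ).  Then Cₙ₊₁ = Cₙ ∩ ⋂_{b ∈ 𝔸ₙ} wₙ(b)⁻¹Cₙ is again in p, so
-- wₙ₀(a₀) ⋯ wₙₗ(aₗ) ∈ Cₙ₀ ⊆ D by induction on l; and since Nₙ₊₁ exceeds every Nₙ+tᵢ,
-- the τ(wₙ) are sums of x over disjoint consecutive blocks of indices.
module Submission where

open import Defs
open import Level using (0ℓ)
open import Data.Nat using (ℕ; zero; suc; _+_; _≤_; _<_; _≤′_; ≤′-refl; ≤′-step; z≤n; s≤s)
open import Data.Nat.Properties
  using (+-identityʳ; +-assoc; m≤m+n; m≤n+m; ≤-refl; ≤-trans; <-trans; n≤1+n; +-monoʳ-<; m<n⇒n≢0; ≤⇒≤′)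
open import Data.Fin using (Fin; zero; suc; fromℕ)
open import Data.Vec.Functional using () renaming (_∷_ to _◂_)
open import Data.Maybe using (Maybe; just; nothing; fromMaybe)
open import Data.List using (List; []; _∷_; _++_; replicate; map)
open import Data.List.NonEmpty using (List⁺; _∷_; _⁺++⁺_; toList)
  renaming (map to map⁺; replicate to replicate⁺)
open import Data.List.NonEmpty.Properties using (map-⁺++⁺; map-∘; map-id)
open import Data.List.Membership.Propositional using (_∈_)
open import Data.List.Membership.Propositional.Properties using (∈-map⁺)
open import Data.List.Relation.Unary.Any using (here; there)
open import Data.Product using (Σ; Σ-syntax; _×_; _,_; proj₁; proj₂)
open import Data.Sum using (inj₁; inj₂)
open import Data.Empty using (⊥-elim)
open import Data.Unit using (tt)
open import Relation.Nullary using (¬_)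
open import Relation.Unary using (Pred; _⊆_; _∩_; U; ∅)
open import Relation.Binary using (Rel; Reflexive; Transitive)
open import Relation.Binary.PropositionalEquality
  using (_≡_; _≢_; refl; sym; trans; cong; cong₂; subst; module ≡-Reasoning)
open import Function using (_∘_)

chain⇒monotone : ∀ {a ℓ} {X : Set a} (_R_ : Rel X ℓ) → Reflexive _R_ → Transitive _R_
  → (f : ℕ → X) → (∀ n → f n R f (suc n)) → ∀ {m n} → m ≤ n → f m R f n
chain⇒monotone _R_ R-refl R-trans f step = go ∘ ≤⇒≤′
  where
  go : ∀ {m n} → m ≤′ n → f m R f n
  go ≤′-refl         = R-refl
  go (≤′-step m≤′n) = R-trans (go m≤′n) (step _)

StrictlyIncreasing-tail : ∀ {l} {n : Fin (suc l) → ℕ}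
  → StrictlyIncreasingℕ n → StrictlyIncreasingℕ (n ∘ suc)
StrictlyIncreasing-tail n-inc i j i<j = n-inc (suc i) (suc j) (s≤s i<j)

∑-≤ : ∀ l (f : Fin (suc l) → ℕ) i → f i ≤ ∑ (suc l) f
∑-≤ l       f zero    = m≤m+n (f zero) _
∑-≤ (suc l) f (suc i) = ≤-trans (∑-≤ l (f ∘ suc) i) (m≤n+m _ (f zero))

fromNonEmpty : ∀ {X : Set} (L : List X) → ¬ L ≡ [] → List⁺ X
fromNonEmpty []       L≢[] = ⊥-elim (L≢[] refl)
fromNonEmpty (b ∷ bs) _    = b ∷ bs

∈-map-fromNonEmpty : ∀ {X Y : Set} (f : X → Y) (L : List X) (L≢[] : ¬ L ≡ []) {b}
  → b ∈ L → f b ∈ toList (map⁺ f (fromNonEmpty L L≢[]))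
∈-map-fromNonEmpty f (_ ∷ _) _ b∈L = ∈-map⁺ f b∈L

module _ {S T : Set} (_∙_ : S → S → S) (_∗_ : T → T → T) where
  private
    module Sᴶ = SemigroupNotions S _∙_
    module Tᴶ = SemigroupNotions T _∗_

  jprod-homomorphic : (h : S → T) → (∀ u v → h (u ∙ v) ≡ h u ∗ h v)
    → ∀ m a y {a′ y′} → (∀ i → h (a i) ≡ a′ i) → (∀ i → h (y i) ≡ y′ i)
    → h (Sᴶ.jprod m a y) ≡ Tᴶ.jprod m a′ y′
  jprod-homomorphic h h-hom zero    a y ha hy = ha zero
  jprod-homomorphic h h-hom (suc m) a y {a′} {y′} ha hy = begin
    h ((a zero ∙ y zero) ∙ Sᴶ.jprod m (a ∘ suc) (y ∘ suc))
      ≡⟨ h-hom _ _ ⟩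
    h (a zero ∙ y zero) ∗ h (Sᴶ.jprod m (a ∘ suc) (y ∘ suc))
      ≡⟨ cong₂ _∗_ (trans (h-hom _ _) (cong₂ _∗_ (ha zero) (hy zero)))
                   (jprod-homomorphic h h-hom m (a ∘ suc) (y ∘ suc) (ha ∘ suc) (hy ∘ suc)) ⟩
    (a′ zero ∗ y′ zero) ∗ Tᴶ.jprod m (a′ ∘ suc) (y′ ∘ suc)
      ∎
    where open ≡-Reasoning

jprod-+-zeros : ∀ m (y : Fin m → ℕ) → SemigroupNotions.jprod ℕ _+_ m (λ _ → 0) y ≡ ∑ m y
jprod-+-zeros zero    y = refl
jprod-+-zeros (suc m) y = cong (y zero +_) (jprod-+-zeros m (y ∘ suc))

module FilterProperties {S : Set} {_∙_ : S → S → S} {p : Pred (Pred S 0ℓ) 0ℓ}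
  (p-ultra : SemigroupNotions.IsUltrafilter S _∙_ p) where
  open SemigroupNotions S _∙_ using (_⁻¹·_; IsIdempotent)
  open SemigroupNotions.IsUltrafilter p-ultra

  U∈p : p U
  U∈p with ultra ∅
  ... | inj₁ ∅∈p  = ⊥-elim (empty∉ ∅∈p)
  ... | inj₂ ∁∅∈p = upward ∁∅∈p (λ _ → tt)

  ⋂-∈ : ∀ {I : Set} (L : List I) (E : I → Pred S 0ℓ)
    → (∀ b → b ∈ L → p (E b)) → p (λ y → ∀ b → b ∈ L → E b y)
  ⋂-∈ []      E E∈p = upward U∈p (λ _ b ())
  ⋂-∈ (c ∷ L) E E∈p = upward (inter (E∈p c (here refl)) (⋂-∈ L E (λ b → E∈p b ∘ there)))
    λ { (y∈Ec , y∈⋂) _ (here refl) → y∈Ec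
      ; (y∈Ec , y∈⋂) b (there b∈L) → y∈⋂ b b∈L }

  _⋆ : Pred S 0ℓ → Pred S 0ℓ
  C ⋆ = C ∩ (λ y → p (y ⁻¹· C))

  ⋆∈p : IsIdempotent p → ∀ {C} → p C → p (C ⋆)
  ⋆∈p p-idem {C} C∈p = inter C∈p (proj₂ (p-idem C) C∈p)

module FiniteSums (x : ℕ → ℕ) where

  FSIn : ℕ → ℕ → Pred ℕ 0ℓ
  FSIn lo hi s = Σ[ l ∈ ℕ ] Σ[ n ∈ (Fin (suc l) → ℕ) ]
    (StrictlyIncreasingℕ n × (∀ i → lo ≤ n i) × (∀ i → n i < hi) × s ≡ ∑ (suc l) (x ∘ n))

  FSIn⇒FS : ∀ {lo hi s} → FSIn lo hi s → FS x s
  FSIn⇒FS (l , n , n-inc , _ , _ , s≡) = l , n , n-inc , s≡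

  FSIn-weaken : ∀ {lo lo′ hi s} → lo ≤ lo′ → FSIn lo′ hi s → FSIn lo hi s
  FSIn-weaken lo≤lo′ (l , n , n-inc , lo′≤n , n<hi , s≡) =
    l , n , n-inc , (≤-trans lo≤lo′ ∘ lo′≤n) , n<hi , s≡

  FSIn-cons : ∀ {lo hi j s} → lo ≤ j → FSIn (suc j) hi s → FSIn lo hi (x j + s)
  FSIn-cons {lo} {hi} {j} lo≤j (l , n , n-inc , j<n , n<hi , refl) =
    suc l , j ◂ n , jn-inc , lo≤jn , jn<hi , refl
    where
    jn-inc : StrictlyIncreasingℕ (j ◂ n)
    jn-inc zero    (suc k) _         = j<n k
    jn-inc (suc i) (suc k) (s≤s i<k) = n-inc i k i<k
    lo≤jn : ∀ i → lo ≤ (j ◂ n) i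
    lo≤jn zero    = lo≤j
    lo≤jn (suc i) = ≤-trans lo≤j (≤-trans (n≤1+n j) (j<n i))
    jn<hi : ∀ i → (j ◂ n) i < hi
    jn<hi zero    = <-trans (j<n zero) (n<hi zero)
    jn<hi (suc i) = n<hi i

  FSIn-prepend : ∀ {lo mid hi s′} l (n : Fin (suc l) → ℕ) → StrictlyIncreasingℕ n
    → (∀ i → lo ≤ n i) → (∀ i → n i < mid) → FSIn mid hi s′ → FSIn lo hi (∑ (suc l) (x ∘ n) + s′)
  FSIn-prepend {s′ = s′} zero n _ lo≤n n<mid r =
    subst (λ q → FSIn _ _ (q + s′)) (sym (+-identityʳ (x (n zero))))
      (FSIn-cons (lo≤n zero) (FSIn-weaken (n<mid zero) r))
  FSIn-prepend {s′ = s′} (suc l) n n-inc lo≤n n<mid r =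
    subst (FSIn _ _) (sym (+-assoc (x (n zero)) (∑ (suc l) (x ∘ n ∘ suc)) s′))
      (FSIn-cons (lo≤n zero)
        (FSIn-prepend l (n ∘ suc) (StrictlyIncreasing-tail n-inc)
          (λ i → n-inc zero (suc i) (s≤s z≤n)) (n<mid ∘ suc) r))

  FSIn-++ : ∀ {lo mid hi s s′} → FSIn lo mid s → FSIn mid hi s′ → FSIn lo hi (s + s′)
  FSIn-++ (l , n , n-inc , lo≤n , n<mid , refl) = FSIn-prepend l n n-inc lo≤n n<mid

module WordProperties (A : Set) where
  open Words A

  countV-++ : ∀ u u′ → countV (u ++ u′) ≡ countV u + countV u′
  countV-++ []            u′ = refl
  countV-++ (nothing ∷ u) u′ = cong suc (countV-++ u u′)
  countV-++ (just _ ∷ u)  u′ = countV-++ u u′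

  τ-⁺++⁺ : ∀ u u′ → τ (u ⁺++⁺ u′) ≡ τ u + τ u′
  τ-⁺++⁺ u u′ = countV-++ (toList u) (toList u′)

  countV-map-just : ∀ (u : List A) → countV (map just u) ≡ 0
  countV-map-just []      = refl
  countV-map-just (_ ∷ u) = countV-map-just u

  τ-map-just : ∀ (u : List⁺ A) → τ (map⁺ just u) ≡ 0
  τ-map-just (_ ∷ u) = countV-map-just u

  countV-replicate-v : ∀ k → countV (replicate k nothing) ≡ k
  countV-replicate-v zero    = refl
  countV-replicate-v (suc k) = cong suc (countV-replicate-v k)

  τ-replicate-v : ∀ k (k≢0 : k ≢ 0) → τ (replicate⁺ k k≢0 nothing) ≡ k
  τ-replicate-v zero    k≢0 = ⊥-elim (k≢0 refl)
  τ-replicate-v (suc k) _   = cong suc (countV-replicate-v k)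

  map-fromMaybe-just : ∀ b (u : List⁺ A) → map⁺ (fromMaybe b) (map⁺ just u) ≡ u
  map-fromMaybe-just b u = trans (sym (map-∘ u)) (map-id u)

module Construction (A : Set) (𝔸 : ℕ → List A) (𝔸≢[] : ∀ i → ¬ 𝔸 i ≡ [])
  (p : Pred (Pred (List⁺ A) 0ℓ) 0ℓ)
  (p-ultra : SemigroupNotions.IsUltrafilter (List⁺ A) _⁺++⁺_ p)
  (p-idem : SemigroupNotions.IsIdempotent (List⁺ A) _⁺++⁺_ p)
  (p∈J : SemigroupNotions.InJ (List⁺ A) _⁺++⁺_ p)
  (D : Pred (List⁺ A) 0ℓ) (D∈p : p D)
  (x : ℕ → ℕ) (x≥1 : ∀ n → 1 ≤ x n) where

  open Words A
  open WordProperties A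
  open SemigroupNotions S₀ _⁺++⁺_ using (jprod; StrictlyIncreasing; IsJSet)
  private module Vᴶ = SemigroupNotions (List⁺ (Maybe A)) _⁺++⁺_
  open FilterProperties p-ultra
  open SemigroupNotions.IsUltrafilter p-ultra using (inter)
  open FiniteSums x

  v^x : ℕ → List⁺ (Maybe A)
  v^x k = replicate⁺ (x k) (m<n⇒n≢0 (x≥1 k)) nothing

  τ-v^x : ∀ k → τ (v^x k) ≡ x k
  τ-v^x k = τ-replicate-v (x k) (m<n⇒n≢0 (x≥1 k))

  record Stage : Set₁ where
    field
      C   : Pred S₀ 0ℓ
      C∈p : p C
      N   : ℕ

  module Step (n : ℕ) (stage : Stage) where
    open Stage stage

    family : A → ℕ → S₀
    family b t = map⁺ (fromMaybe b) (v^x (N + t))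

    families : List⁺ (ℕ → S₀)
    families = map⁺ family (fromNonEmpty (𝔸 n) (𝔸≢[] n))

    C⋆-isJSet : IsJSet (C ⋆)
    C⋆-isJSet = p∈J (C ⋆) (⋆∈p p-idem C∈p)

    k : ℕ
    k = proj₁ (C⋆-isJSet families)

    α : Fin (suc (suc k)) → S₀
    α = proj₁ (proj₂ (C⋆-isJSet families))

    t : Fin (suc k) → ℕ
    t = proj₁ (proj₂ (proj₂ (C⋆-isJSet families)))

    t-inc : StrictlyIncreasing t
    t-inc = proj₁ (proj₂ (proj₂ (proj₂ (C⋆-isJSet families))))

    jprod∈C⋆ : ∀ b → b ∈ 𝔸 n → (C ⋆) (jprod (suc k) α (family b ∘ t))
    jprod∈C⋆ b b∈ = proj₂ (proj₂ (proj₂ (proj₂ (C⋆-isJSet families)))) (family b)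
      (∈-map-fromNonEmpty family (𝔸 n) (𝔸≢[] n) b∈)

    indices : Fin (suc k) → ℕ
    indices = (N +_) ∘ t

    word : List⁺ (Maybe A)
    word = Vᴶ.jprod (suc k) (map⁺ just ∘ α) (v^x ∘ indices)

    τ-word : τ word ≡ ∑ (suc k) (x ∘ indices)
    τ-word = trans
      (jprod-homomorphic _⁺++⁺_ _+_ τ τ-⁺++⁺ (suc k) (map⁺ just ∘ α) (v^x ∘ indices)
        (τ-map-just ∘ α) (τ-v^x ∘ indices))
      (jprod-+-zeros (suc k) (x ∘ indices))

    w : S₁
    w = word , subst (1 ≤_) (sym τ-word) (≤-trans (x≥1 (indices zero)) (∑-≤ k (x ∘ indices) zero))

    subst₁-w : ∀ b → subst₁ w b ≡ jprod (suc k) α (family b ∘ t)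
    subst₁-w b = jprod-homomorphic _⁺++⁺_ _⁺++⁺_ (map⁺ (fromMaybe b)) (map-⁺++⁺ (fromMaybe b))
      (suc k) (map⁺ just ∘ α) (v^x ∘ indices) (map-fromMaybe-just b ∘ α) (λ _ → refl)

    w∈C⋆ : ∀ b → b ∈ 𝔸 n → (C ⋆) (subst₁ w b)
    w∈C⋆ b b∈ = subst (C ⋆) (sym (subst₁-w b)) (jprod∈C⋆ b b∈)

    next : Stage
    next = record
      { C   = C ∩ (λ y → ∀ b → b ∈ 𝔸 n → C (subst₁ w b ⁺++⁺ y))
      ; C∈p = inter C∈p (⋂-∈ (𝔸 n) (λ b y → C (subst₁ w b ⁺++⁺ y)) (λ b → proj₂ ∘ w∈C⋆ b))
      ; N   = N + suc (∑ (suc k) t)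
      }

    τ-w∈FSIn : FSIn N (Stage.N next) (τ₁ w)
    τ-w∈FSIn = k , indices , (λ i j i<j → +-monoʳ-< N (t-inc i j i<j)) , (m≤m+n N ∘ t) ,
               (λ i → +-monoʳ-< N (s≤s (∑-≤ k t i))) , τ-word

  stage : ℕ → Stage
  stage zero    = record { C = D ; C∈p = D∈p ; N = 0 }
  stage (suc n) = Step.next n (stage n)

  w : ℕ → S₁
  w n = Step.w n (stage n)

  C : ℕ → Pred S₀ 0ℓ
  C = Stage.C ∘ stage

  N : ℕ → ℕ
  N = Stage.N ∘ stage

  C-antitone : ∀ {m m′} → m ≤ m′ → C m′ ⊆ C m
  C-antitone = chain⇒monotone (λ P Q → Q ⊆ P) (λ y∈P → y∈P) (λ Q⊆P R⊆Q → Q⊆P ∘ R⊆Q) C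
    (λ _ → proj₁)

  N-monotone : ∀ {m m′} → m ≤ m′ → N m ≤ N m′
  N-monotone = chain⇒monotone _≤_ ≤-refl ≤-trans N (λ m → m≤m+n (N m) _)

  concat∈C : ∀ l (n : Fin (suc l) → ℕ) → StrictlyIncreasingℕ n
    → (a : Fin (suc l) → A) → (∀ i → a i ∈ 𝔸 (n i))
    → C (n zero) (concatF l (λ i → subst₁ (w (n i)) (a i)))
  concat∈C zero    n _     a a∈ = proj₁ (Step.w∈C⋆ (n zero) (stage (n zero)) (a zero) (a∈ zero))
  concat∈C (suc l) n n-inc a a∈ =
    proj₂ (C-antitone (n-inc zero (suc zero) (s≤s z≤n))
            (concat∈C l (n ∘ suc) (StrictlyIncreasing-tail n-inc) (a ∘ suc) (a∈ ∘ suc)))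
      (a zero) (a∈ zero)

  ∑τ∈FSIn : ∀ l (n : Fin (suc l) → ℕ) → StrictlyIncreasingℕ n
    → FSIn (N (n zero)) (N (suc (n (fromℕ l)))) (∑ (suc l) (λ i → τ₁ (w (n i))))
  ∑τ∈FSIn zero    n _     =
    subst (FSIn _ _) (sym (+-identityʳ _)) (Step.τ-w∈FSIn (n zero) (stage (n zero)))
  ∑τ∈FSIn (suc l) n n-inc =
    FSIn-++ (Step.τ-w∈FSIn (n zero) (stage (n zero)))
      (FSIn-weaken (N-monotone (n-inc zero (suc zero) (s≤s z≤n)))
        (∑τ∈FSIn l (n ∘ suc) (StrictlyIncreasing-tail n-inc)))

mainTheorem6 : (A : Set) (𝔸 : ℕ → List A)
    → (∀ i → ¬ (𝔸 i ≡ List.[]))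
    → (∀ i {a} → a ∈ 𝔸 i → a ∈ 𝔸 (suc i))
    → (∀ a → Σ[ i ∈ ℕ ] (a ∈ 𝔸 i))
    → (D : Pred (List⁺ A) 0ℓ)
    → SemigroupNotions.IsCSet (List⁺ A) _⁺++⁺_ D
    → (x : ℕ → ℕ)
    → (∀ n → 1 ≤ x n)
    → Σ[ w ∈ (ℕ → Words.S₁ A) ]
        ((l : ℕ) (n : Fin (suc l) → ℕ) → StrictlyIncreasingℕ n
          → ((a : Fin (suc l) → A) → (∀ i → a i ∈ 𝔸 (n i))
              → D (Words.concatF A l (λ i → Words.subst₁ A (w (n i)) (a i))))
          × FS x (∑ (suc l) (λ i → Words.τ₁ A (w (n i)))))
mainTheorem6 A 𝔸 𝔸≢[] _ _ D (p , p-ultra , p-idem , p∈J , D∈p) x x≥1 =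
  w , λ l n n-inc →
    (λ a a∈ → C-antitone {m′ = n zero} z≤n (concat∈C l n n-inc a a∈)) ,
    FiniteSums.FSIn⇒FS x (∑τ∈FSIn l n n-inc)
  where open Construction A 𝔸 𝔸≢[] p p-ultra p-idem p∈J D D∈p x x≥1
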